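{- Let $G=(V,E)$ be a finite colored graph, let $V_i$ denote the set of nodes of color $i$, let $q$ be the maximum over all colors $i$ of the number of connected components of $G[V_i]$, and let $s,t$ be distinct non-adjacent nodes. Let $G''$ be the graph constructed as in the context. Then the $s''t''$ node connectivity of $G''$ is at most $q$ times the value of the minimum color $st$ node cut in $G$.
   Context: Construction of $G''$: contract each connected component of each $G[V_i]$ into a single node carrying color $i$; two contracted nodes are adjacent if and only if $G$ has at least one edge between the corresponding components; add a new node $s''$ adjacent to exactly those contracted nodes whose component contains a node adjacent to $s$, and a new node $t''$ adjacent to exactly those contracted nodes whose component contains a node adjacent to $t$. For distinct non-adjacent nodes $x,y$, an $xy$ node cut is a set of nodes not containing $x,y$ whose removal leaves $x$ and $y$ in different components; the $xy$ node connectivity is the minimum size of such a cut. A color $st$ node cut of $G$ is a set $C_c$ of colors such that the set of nodes whose colors lie in $C_c$ (possibly including $s$ or $t$) contains an $st$ node cut; the value of the minimum color $st$ node cut is the minimum size of such a $C_c$. -}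

module Defs where

open import Data.Nat using (ℕ; _≤_; _*_; _⊔_)
open import Data.Fin using (Fin)
open import Data.Fin.Properties using (_≟_)
open import Data.List using (List; length; filter; map; foldr; allFin)
open import Data.List.Membership.Propositional using (_∈_)
open import Data.List.Relation.Unary.Unique.Propositional using (Unique)
open import Data.Product using (_×_; ∃; ∃-syntax; Σ-syntax)
open import Data.Empty using (⊥)
open import Relation.Nullary using (¬_)
open import Relation.Binary.PropositionalEquality using (_≡_; _≢_)

-- Conn Adj Ok x y : there is a walk from x to y in which every node
-- (including x and y) satisfies Ok, i.e. x,y connected in G[Ok].
data Conn {V : Set} (Adj : V → V → Set) (Ok : V → Set) : V → V → Set where
  here : ∀ {x} → Ok x → Conn Adj Ok x x
  step : ∀ {x y z} → Ok x → Adj x y → Conn Adj Ok y z → Conn Adj Ok x z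

IsNodeCut : {V : Set} → (V → V → Set) → V → V → (V → Set) → Set
IsNodeCut Adj x y X = ¬ X x × ¬ X y × ¬ Conn Adj (λ w → ¬ X w) x y

-- κ is the xy node connectivity: minimum size of an xy node cut
-- (finite node sets given as duplicate-free lists).
IsNodeConnectivity : {V : Set} → (V → V → Set) → V → V → ℕ → Set
IsNodeConnectivity Adj x y κ =
  (∃[ L ] (Unique L × length L ≡ κ × IsNodeCut Adj x y (_∈ L)))
  × (∀ L → Unique L → IsNodeCut Adj x y (_∈ L) → κ ≤ length L)

SameComp : ∀ {n k} → (Fin n → Fin n → Set) → (Fin n → Fin k) → Fin n → Fin n → Set
SameComp Adj col u v = col u ≡ col v × Conn Adj (λ w → col w ≡ col u) u v

IsColorCut : ∀ {n k} → (Fin n → Fin n → Set) → (Fin n → Fin k) →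
             Fin n → Fin n → List (Fin k) → Set
IsColorCut Adj col s t Cc =
  ∃[ X ] ((∀ v → v ∈ X → col v ∈ Cc) × IsNodeCut Adj s t (_∈ X))

IsMinColorCut : ∀ {n k} → (Fin n → Fin n → Set) → (Fin n → Fin k) →
                Fin n → Fin n → ℕ → Set
IsMinColorCut Adj col s t m =
  (∃[ Cc ] (Unique Cc × length Cc ≡ m × IsColorCut Adj col s t Cc))
  × (∀ Cc → Unique Cc → IsColorCut Adj col s t Cc → m ≤ length Cc)

-- Its contracted nodes are Fin N, given by a labelling comp : Fin n → Fin N
-- that is onto and identifies exactly the nodes in the same component of
-- some G[V_i] (i.e. Fin N is the set of those components).

IsComponentLabelling : ∀ {n k N} → (Fin n → Fin n → Set) → (Fin n → Fin k) →
                       (Fin n → Fin N) → Set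
IsComponentLabelling Adj col comp =
  (∀ x → ∃[ u ] (comp u ≡ x))
  × (∀ u v → comp u ≡ comp v → SameComp Adj col u v)
  × (∀ u v → SameComp Adj col u v → comp u ≡ comp v)

IsContractedColoring : ∀ {n k N} → (Fin n → Fin k) → (Fin n → Fin N) →
                       (Fin N → Fin k) → Set
IsContractedColoring col comp col'' = ∀ u → col'' (comp u) ≡ col u

data Node'' (N : ℕ) : Set where
  ctr : Fin N → Node'' N
  s'' : Node'' N
  t'' : Node'' N

Adj'' : ∀ {n N} → (Fin n → Fin n → Set) → (Fin n → Fin N) → Fin n → Fin n →
        Node'' N → Node'' N → Set
Adj'' Adj comp s t (ctr x) (ctr y) =
  x ≢ y × ∃[ u ] ∃[ v ] (comp u ≡ x × comp v ≡ y × Adj u v)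
Adj'' Adj comp s t s'' (ctr x) = ∃[ u ] (comp u ≡ x × Adj s u)
Adj'' Adj comp s t (ctr x) s'' = ∃[ u ] (comp u ≡ x × Adj s u)
Adj'' Adj comp s t t'' (ctr x) = ∃[ u ] (comp u ≡ x × Adj t u)
Adj'' Adj comp s t (ctr x) t'' = ∃[ u ] (comp u ≡ x × Adj t u)
Adj'' Adj comp s t _ _ = ⊥

-- number of connected components of G[V_i] = number of contracted nodes of color i
numComps : ∀ {N k} → (Fin N → Fin k) → Fin k → ℕ
numComps {N} col'' i = length (filter (λ x → col'' x ≟ i) (allFin N))

maxComps : ∀ {N k} → (Fin N → Fin k) → ℕ
maxComps {N} {k} col'' = foldr _⊔_ 0 (map (numComps col'') (allFin k))

module Submission where

-- Take a minimum color st cut Cc together with an st node cut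
-- X of G all of whose nodes have colors in Cc.  Let L be the set of
-- contracted nodes of G'' whose color lies in Cc.
--   * L is an s''t'' node cut: a contracted node outside L is a component
--     whose nodes all avoid X and which is connected inside G[V_i], so every
--     s''t'' walk of G'' avoiding L lifts to an st walk of G avoiding X.
--   * |L| ≤ q·|Cc|, since each color of Cc contributes at most q contracted
--     nodes.
-- Hence κ ≤ |L| ≤ q·m.

open import Defs
open import Data.Nat using (ℕ; _≤_; _*_; _+_; _⊔_; z≤n; s≤s)
open import Data.Nat.Properties
  using ( module ≤-Reasoning; ≤-refl; ≤-trans; n≤1+n; m≤m⊔n; m≤n⊔m
        ; +-mono-≤; +-monoˡ-≤; +-monoʳ-≤; +-suc; *-comm)
open import Data.Fin using (Fin)
open import Data.Fin.Properties using (_≟_)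
open import Data.Product using (_×_; _,_; ∃-syntax)
open import Data.Sum using (_⊎_; inj₁; inj₂)
open import Data.List using (List; []; _∷_; length; filter; map; foldr; allFin)
open import Data.List.Properties using (filter-accept; length-map)
open import Data.List.Membership.Propositional using (_∈_)
open import Data.List.Membership.Propositional.Properties
  using (∈-filter⁺; ∈-allFin; ∈-map⁺; ∈-map⁻)
open import Data.List.Relation.Unary.Any using (here; there)
open import Data.List.Relation.Unary.Unique.Propositional using (Unique)
import Data.List.Relation.Unary.Unique.Propositional.Properties as Unique
open import Relation.Nullary using (¬_; yes; no)
open import Relation.Unary using (Decidable)
open import Relation.Binary.PropositionalEquality
  using (_≡_; _≢_; refl; sym; trans; cong; subst)

Conn-mono : {V : Set} {Adj : V → V → Set} {P Q : V → Set} →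
            (∀ w → P w → Q w) → ∀ {x y} → Conn Adj P x y → Conn Adj Q x y
Conn-mono P⊆Q (here p)       = here (P⊆Q _ p)
Conn-mono P⊆Q (step p a xy) = step (P⊆Q _ p) a (Conn-mono P⊆Q xy)

Conn-join : {V : Set} {Adj : V → V → Set} {P : V → Set} {x y z w : V} →
            Conn Adj P x y → Adj y z → Conn Adj P z w → Conn Adj P x w
Conn-join (here p)       a zw = step p a zw
Conn-join (step p a′ xy) a zw = step p a′ (Conn-join xy a zw)

module Lifting {n N : ℕ} (Adj : Fin n → Fin n → Set)
               (Adj-sym : ∀ u v → Adj u v → Adj v u)
               (comp : Fin n → Fin N) (s t : Fin n) where

  Adj″ : Node'' N → Node'' N → Set
  Adj″ = Adj'' Adj comp s t

  ctr-injective : ∀ {x y : Fin N} → ctr {N} x ≡ ctr y → x ≡ y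
  ctr-injective refl = refl

  s''∉ctrs : ∀ (xs : List (Fin N)) → ¬ s'' ∈ map ctr xs
  s''∉ctrs xs p with ∈-map⁻ ctr p
  ... | _ , _ , ()

  t''∉ctrs : ∀ (xs : List (Fin N)) → ¬ t'' ∈ map ctr xs
  t''∉ctrs xs p with ∈-map⁻ ctr p
  ... | _ , _ , ()

  Lies-in : Node'' N → Fin n → Set
  Lies-in (ctr x) u = comp u ≡ x
  Lies-in s''     u = u ≡ s
  Lies-in t''     u = u ≡ t

  edge-witness : ∀ {a b} → Adj″ a b →
                 ∃[ u ] ∃[ v ] (Lies-in a u × Lies-in b v × Adj u v)
  edge-witness {ctr x} {ctr y} (_ , u , v , eu , ev , e) = u , v , eu , ev , e
  edge-witness {s''}   {ctr y} (v , ev , e) = s , v , refl , ev , e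
  edge-witness {t''}   {ctr y} (v , ev , e) = t , v , refl , ev , e
  edge-witness {ctr x} {s''}   (u , eu , e) = u , s , eu , refl , Adj-sym s u e
  edge-witness {ctr x} {t''}   (u , eu , e) = u , t , eu , refl , Adj-sym t u e
  edge-witness {s''}   {s''}   ()
  edge-witness {s''}   {t''}   ()
  edge-witness {t''}   {s''}   ()
  edge-witness {t''}   {t''}   ()

  lift-walk : {Ok″ : Node'' N → Set} {Ok : Fin n → Set} →
              (∀ {a u v} → Ok″ a → Lies-in a u → Lies-in a v → Conn Adj Ok u v) →
              ∀ {a b u v} → Conn Adj″ Ok″ a b → Lies-in a u → Lies-in b v →
              Conn Adj Ok u v
  lift-walk inside (here ok) au av = inside ok au av
  lift-walk inside (step ok e walk) au bv with edge-witness e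
  ... | u′ , v′ , au′ , cv′ , e′ =
    Conn-join (inside ok au au′) e′ (lift-walk inside walk cv′ bv)

length-filter-∷ : {A : Set} {S : A → Set} (S? : Decidable S) (x : A) (xs : List A) →
                  length (filter S? xs) ≤ length (filter S? (x ∷ xs))
length-filter-∷ S? x xs with S? x
... | yes _ = n≤1+n _
... | no _  = ≤-refl

length-filter-∪ : {A : Set} {P Q R : A → Set}
                  (P? : Decidable P) (Q? : Decidable Q) (R? : Decidable R) →
                  (∀ x → P x → Q x ⊎ R x) → (xs : List A) →
                  length (filter P? xs) ≤ length (filter Q? xs) + length (filter R? xs)
length-filter-∪ P? Q? R? P⊆Q∪R []       = z≤n
length-filter-∪ P? Q? R? P⊆Q∪R (x ∷ xs) with P? x
... | no _ =
  ≤-trans IH (+-mono-≤ (length-filter-∷ Q? x xs) (length-filter-∷ R? x xs))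
  where IH = length-filter-∪ P? Q? R? P⊆Q∪R xs
... | yes p with P⊆Q∪R x p
...   | inj₁ q rewrite filter-accept Q? {xs = xs} q =
  s≤s (≤-trans IH (+-monoʳ-≤ _ (length-filter-∷ R? x xs)))
  where IH = length-filter-∪ P? Q? R? P⊆Q∪R xs
...   | inj₂ r rewrite filter-accept R? {xs = xs} r
                   | +-suc (length (filter Q? (x ∷ xs))) (length (filter R? xs)) =
  s≤s (≤-trans IH (+-monoˡ-≤ _ (length-filter-∷ Q? x xs)))
  where IH = length-filter-∪ P? Q? R? P⊆Q∪R xs

≤-max-map : {A : Set} (f : A → ℕ) {x : A} {xs : List A} →
            x ∈ xs → f x ≤ foldr _⊔_ 0 (map f xs)
≤-max-map f (here refl) = m≤m⊔n _ _
≤-max-map f {xs = y ∷ ys} (there x∈ys) = ≤-trans (≤-max-map f x∈ys) (m≤n⊔m (f y) _)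

module _ {A : Set} {k : ℕ} (col : A → Fin k) where
  open import Data.List.Membership.DecPropositional (_≟_ {k}) using (_∈?_)

  length-filter-colors : (xs : List A) (b : ℕ) →
                         (∀ c → length (filter (λ x → col x ≟ c) xs) ≤ b) →
                         (Cc : List (Fin k)) →
                         length (filter (λ x → col x ∈? Cc) xs) ≤ length Cc * b
  length-filter-colors xs b class≤b [] =
    subst (_≤ 0) (sym (length-filter-none xs)) z≤n
    where
    length-filter-none : ∀ xs → length (filter (λ x → col x ∈? []) xs) ≡ 0
    length-filter-none [] = refl
    length-filter-none (x ∷ xs) = length-filter-none xs
  length-filter-colors xs b class≤b (c ∷ Cc) =
    ≤-trans (length-filter-∪ (λ x → col x ∈? (c ∷ Cc)) (λ x → col x ≟ c)
                             (λ x → col x ∈? Cc) split xs)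
            (+-mono-≤ (class≤b c) (length-filter-colors xs b class≤b Cc))
    where
    split : ∀ x → col x ∈ (c ∷ Cc) → col x ≡ c ⊎ col x ∈ Cc
    split x (here e)  = inj₁ e
    split x (there e) = inj₂ e

lemma2 : (n k : ℕ) (Adj : Fin n → Fin n → Set)
    → (∀ u v → Adj u v → Adj v u)
    → (∀ u → ¬ Adj u u)
    → (col : Fin n → Fin k)
    → (s t : Fin n) → s ≢ t → ¬ Adj s t
    → (N : ℕ) (comp : Fin n → Fin N) (col'' : Fin N → Fin k)
    → IsComponentLabelling Adj col comp
    → IsContractedColoring col comp col''
    → (κ m : ℕ)
    → IsNodeConnectivity (Adj'' Adj comp s t) s'' t'' κ
    → IsMinColorCut Adj col s t m
    → κ ≤ maxComps col'' * m
lemma2 n k Adj Adj-sym _ col s t _ _ N comp col'' (_ , same-comp , _) col''∘comp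
       κ m (_ , κ-minimal) ((Cc , _ , |Cc|≡m , X , X⊆Cc , s∉X , t∉X , X-cuts) , _) =
  begin
    κ              ≤⟨ κ-minimal L L-unique L-cuts ⟩
    length L       ≡⟨ length-map ctr F ⟩
    length F       ≤⟨ length-filter-colors col'' (allFin N) q class≤q Cc ⟩
    length Cc * q  ≡⟨ cong (_* q) |Cc|≡m ⟩
    m * q          ≡⟨ *-comm m q ⟩
    q * m          ∎
  where
  open ≤-Reasoning
  open Lifting Adj Adj-sym comp s t
  open import Data.List.Membership.DecPropositional (_≟_ {k}) using (_∈?_)

  q : ℕ
  q = maxComps col''

  F : List (Fin N)
  F = filter (λ x → col'' x ∈? Cc) (allFin N)
  L : List (Node'' N)
  L = map ctr F

  class≤q : ∀ c → length (filter (λ x → col'' x ≟ c) (allFin N)) ≤ q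
  class≤q c = ≤-max-map (numComps col'') (∈-allFin c)

  L-unique : Unique L
  L-unique = Unique.map⁺ ctr-injective (Unique.filter⁺ _ (Unique.allFin⁺ N))

  -- A component outside L has a color outside Cc, so none of its nodes is in X.
  outside-L-avoids-X : ∀ u → ¬ ctr (comp u) ∈ L → ∀ w → col w ≡ col u → ¬ w ∈ X
  outside-L-avoids-X u u∉L w cw w∈X =
    u∉L (∈-map⁺ ctr (∈-filter⁺ _ (∈-allFin (comp u))
          (subst (_∈ Cc) (trans cw (sym (col''∘comp u))) (X⊆Cc w w∈X))))

  inside-walk : ∀ {a u v} → ¬ a ∈ L → Lies-in a u → Lies-in a v →
                Conn Adj (λ w → ¬ w ∈ X) u v
  inside-walk {ctr _} {u} {v} a∉L refl cv with same-comp u v (sym cv)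
  ... | _ , walk = Conn-mono (outside-L-avoids-X u a∉L) walk
  inside-walk {s''} _ refl refl = here s∉X
  inside-walk {t''} _ refl refl = here t∉X

  -- An s''t'' walk avoiding L would lift to an st walk avoiding X.
  L-cuts : IsNodeCut (Adj'' Adj comp s t) s'' t'' (_∈ L)
  L-cuts = s''∉ctrs F , t''∉ctrs F ,
           λ walk → X-cuts (lift-walk inside-walk walk refl refl)
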